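{- Let $G$ be a finite simple graph. Every odd dominating set of $G$ contains an odd number of vertices of odd degree if and only if $\nu(G)$ is odd, and every odd dominating set of $G$ contains an even number of vertices of odd degree if and only if $\nu(G)$ is even. In particular, the odd dominating set of an always solvable graph contains an even number of vertices of odd degree.
   Context: For a vertex $u$ of a finite simple graph $G$, $N[u]=\{w\in V(G) : w \text{ adjacent to } u \text{ or } w=u\}$. A set $S\subseteq V(G)$ is an odd dominating set if $|N[u]\cap S|$ is odd for every $u\in V(G)$. With $V(G)=\{v_1,\dots,v_n\}$, the closed neighborhood matrix $N(G)$ is the $n\times n$ matrix over $\mathbb{Z}_2$ whose $i$-th column is the characteristic vector of $N[v_i]$; the nullity $\nu(G)$ is the dimension over $\mathbb{Z}_2$ of its kernel. $G$ is always solvable if $\nu(G)=0$ (equivalently, for every $C\subseteq V(G)$ there is $S$ with $|N[u]\cap S|$ odd exactly for $u\in C$); in that case the odd dominating set is unique. -}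

module Defs where

open import Data.Nat using (ℕ; zero; suc; _+_; _%_)
open import Data.Bool using (Bool; true; false; _∧_; _xor_; if_then_else_)
open import Data.Fin using (Fin; zero; suc; _≟_)
open import Relation.Nullary.Decidable using (does)
open import Relation.Binary.PropositionalEquality using (_≡_)
open import Data.Product using (Σ; _×_)

-- A finite simple graph on vertex set Fin n (v_1..v_n ↦ 0..n-1):
-- symmetric, loopless adjacency relation.
record Graph (n : ℕ) : Set where
  field
    adj   : Fin n → Fin n → Bool
    sym   : ∀ u v → adj u v ≡ adj v u
    loopless : ∀ u → adj u u ≡ false
open Graph public

-- subsets of V(G) / vectors over ℤ₂ (true = 1, false = 0)
Vect : ℕ → Set
Vect n = Fin n → Bool

count : ∀ {n} → Vect n → ℕ
count {zero}  f = 0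
count {suc n} f = (if f zero then 1 else 0) + count (λ i → f (suc i))

Odd : ℕ → Set
Odd m = m % 2 ≡ 1

Even : ℕ → Set
Even m = m % 2 ≡ 0

isOddB : ℕ → Bool
isOddB m = does (m % 2 Data.Nat.≟ 1)

⊕ : ∀ {n} → Vect n → Bool
⊕ {zero}  f = false
⊕ {suc n} f = f zero xor ⊕ (λ i → f (suc i))

inN : ∀ {n} → Graph n → Fin n → Fin n → Bool
inN G u w = if does (w ≟ u) then true else adj G u w

degree : ∀ {n} → Graph n → Fin n → ℕ
degree G u = count (adj G u)

OddDominating : ∀ {n} → Graph n → Vect n → Set
OddDominating G S = ∀ u → Odd (count (λ w → inN G u w ∧ S w))

oddDegreeCount : ∀ {n} → Graph n → Vect n → ℕ
oddDegreeCount G S = count (λ v → S v ∧ isOddB (degree G v))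

-- closed neighbourhood matrix N(G): column i is the characteristic vector of N[v_i],
-- i.e. entry (r , i) = [v_r ∈ N[v_i]].
NMat : ∀ {n} → Graph n → Fin n → Fin n → Bool
NMat G r i = inN G i r

InKernel : ∀ {n} → Graph n → Vect n → Set
InKernel G x = ∀ r → ⊕ (λ i → NMat G r i ∧ x i) ≡ false

lincomb : ∀ {n k} → (Fin k → Vect n) → Vect k → Vect n
lincomb b c r = ⊕ (λ j → c j ∧ b j r)

IsKernelBasis : ∀ {n k} → Graph n → (Fin k → Vect n) → Set
IsKernelBasis {n} {k} G b =
  (∀ j → InKernel G (b j))
  × (∀ (c : Vect k) → (∀ r → lincomb b c r ≡ false) → ∀ j → c j ≡ false)
  × (∀ (x : Vect n) → InKernel G x → Σ (Vect k) (λ c → ∀ r → lincomb b c r ≡ x r))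

Nullity : ∀ {n} → Graph n → ℕ → Set
Nullity {n} G k = Σ (Fin k → Vect n) (IsKernelBasis G)

-- Over ℤ₂ the diagonal d of a symmetric matrix M lies in the column space of M, and every
-- solution of M s = d has s · d ≡ rank M = n − ν (mod 2). Both facts are proved together by
-- induction on n: a diagonal pivot M i i = 1 is eliminated by passing to the Schur complement
-- N + a aᵀ, a hyperbolic pair M 0 j = 1 (with zero diagonal) to N + a cᵀ + c aᵀ, and a zero
-- row is simply deleted; the kernel dimension is preserved in the first two cases and drops
-- by one in the last.
-- For a graph, N(G) is symmetric with diagonal 1, so the odd dominating sets are exactly the
-- solutions of N(G) S = 1. Double counting gives Σ_{v ∈ S} deg v ≡ Σ_w |N(w) ∩ S|, and each
-- summand is 1 + [w ∈ S] when S is odd dominating; hence the number of odd-degree vertices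
-- of S is ≡ n + |S| ≡ n + (n − ν) ≡ ν.

{-# OPTIONS --safe #-}
module Submission where

open import Data.Bool using (Bool; true; false; not; _∧_; _xor_; if_then_else_)
import Data.Bool as Bool
open import Data.Bool.Properties
  using ( ∧-comm; ∧-assoc; ∧-zeroʳ; ∧-identityʳ; ∧-idem; ∧-conicalʳ; ∧-distribˡ-xor; ∧-distribʳ-xor
        ; xor-same; xor-comm; not-involutive; not-distribˡ-xor; xor-annihilates-not; ¬-not
        ; xor-∧-commutativeRing)
open import Data.Fin using (Fin; zero; suc; punchIn; punchOut)
import Data.Fin.Properties as Fin
open import Data.Maybe using (just; nothing)
open import Data.Nat using (ℕ; zero; suc; _<_; _%_)
open import Data.Nat.Induction using (<-rec)
open import Data.Nat.Properties using (n<1+n; m<n⇒m<1+n)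
open import Data.Product using (∃; _×_; _,_; proj₁; proj₂)
open import Data.Vec.Functional using (_∷_; insertAt; removeAt; tail)
open import Data.Vec.Functional.Properties using (insertAt-lookup; insertAt-punchIn; removeAt-insertAt)
open import Function.Base using (_∘_)
open import Function.Bundles using (_⇔_; mk⇔; Equivalence)
import Function.Properties.Equivalence as ⇔
open import Level using (0ℓ)
open import Relation.Binary.PropositionalEquality
open import Relation.Nullary using (yes; no; contradiction)
open import Relation.Nullary.Decidable using (dec-true; dec-false)
open import Tactic.RingSolver using (solve-∀)
import Tactic.RingSolver.Core.AlmostCommutativeRing as ACR

open import Defs hiding (sym)

-- Vectors over ℤ₂ = (Bool, xor, ∧)

ℤ₂ : ACR.AlmostCommutativeRing 0ℓ 0ℓ
-- Recognising the zero coefficient is what lets the solver cancel x xor x.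
ℤ₂ = ACR.fromCommutativeRing xor-∧-commutativeRing λ { false → just refl ; true → nothing }

xor-cancelʳ : ∀ a b → (a xor b) xor b ≡ a
xor-cancelʳ = solve-∀ ℤ₂

xor-cancelˡ : ∀ a b → a xor (a xor b) ≡ b
xor-cancelˡ = solve-∀ ℤ₂

xor-moveʳ : ∀ {a b c} → a xor b ≡ c → a ≡ c xor b
xor-moveʳ {a} {b} refl = sym (xor-cancelʳ a b)

xor-interchange : ∀ a b c d → (a xor b) xor (c xor d) ≡ (a xor c) xor (b xor d)
xor-interchange = solve-∀ ℤ₂

xor-leftComm : ∀ a b c → a xor (b xor c) ≡ b xor (a xor c)
xor-leftComm = solve-∀ ℤ₂

infixl 6 _+ᵥ_
infixr 7 _*ₛ_
infix  8 _·_

0ᵥ : ∀ {n} → Vect n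
0ᵥ _ = false

_+ᵥ_ : ∀ {n} → Vect n → Vect n → Vect n
(x +ᵥ y) t = x t xor y t

_*ₛ_ : ∀ {n} → Bool → Vect n → Vect n
(a *ₛ x) t = a ∧ x t

≗-punchIn : ∀ {n} {A : Set} (i : Fin (suc n)) {x y : Fin (suc n) → A} →
            x i ≡ y i → removeAt x i ≗ removeAt y i → x ≗ y
≗-punchIn i {x} {y} xᵢ≡yᵢ rest t with i Fin.≟ t
... | yes refl = xᵢ≡yᵢ
... | no i≢t   = subst (λ u → x u ≡ y u) (Fin.punchIn-punchOut i≢t) (rest (punchOut i≢t))

⊕-cong : ∀ {n} {f g : Vect n} → f ≗ g → ⊕ f ≡ ⊕ g
⊕-cong {zero}  f≗g = refl
⊕-cong {suc n} f≗g = cong₂ _xor_ (f≗g zero) (⊕-cong (f≗g ∘ suc))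

⊕-0ᵥ : ∀ n → ⊕ (0ᵥ {n}) ≡ false
⊕-0ᵥ zero    = refl
⊕-0ᵥ (suc n) = ⊕-0ᵥ n

⊕-+ᵥ : ∀ {n} (f g : Vect n) → ⊕ (f +ᵥ g) ≡ ⊕ f xor ⊕ g
⊕-+ᵥ {zero}  f g = refl
⊕-+ᵥ {suc n} f g =
  trans (cong ((f zero xor g zero) xor_) (⊕-+ᵥ (tail f) (tail g)))
        (xor-interchange (f zero) (g zero) (⊕ (tail f)) (⊕ (tail g)))

⊕-*ₛ : ∀ {n} a (f : Vect n) → ⊕ (a *ₛ f) ≡ a ∧ ⊕ f
⊕-*ₛ     true  f = refl
⊕-*ₛ {n} false f = ⊕-0ᵥ n

⊕-comm : ∀ {m n} (f : Fin m → Fin n → Bool) → ⊕ (λ i → ⊕ (f i)) ≡ ⊕ (λ j → ⊕ (λ i → f i j))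
⊕-comm {zero}  {n} f = sym (⊕-0ᵥ n)
⊕-comm {suc m}     f = trans (cong (⊕ (f zero) xor_) (⊕-comm (tail f)))
                             (sym (⊕-+ᵥ (f zero) (λ j → ⊕ (λ i → f (suc i) j))))

⊕-punchIn : ∀ {n} (i : Fin (suc n)) (f : Vect (suc n)) → ⊕ f ≡ f i xor ⊕ (removeAt f i)
⊕-punchIn         zero    f = refl
⊕-punchIn {suc n} (suc i) f = trans (cong (f zero xor_) (⊕-punchIn i (tail f)))
                                    (xor-leftComm (f zero) (f (suc i)) _)

⊕≡true⇒∃ : ∀ {n} (f : Vect n) → ⊕ f ≡ true → ∃ λ i → f i ≡ true
⊕≡true⇒∃ {zero}  f ()
⊕≡true⇒∃ {suc n} f ⊕f≡true with f zero in f₀≡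
... | true  = zero , f₀≡
... | false = let i , fᵢ≡true = ⊕≡true⇒∃ (tail f) ⊕f≡true in suc i , fᵢ≡true

_·_ : ∀ {n} → Vect n → Vect n → Bool
x · y = ⊕ (λ t → x t ∧ y t)

·-comm : ∀ {n} (x y : Vect n) → x · y ≡ y · x
·-comm x y = ⊕-cong (λ t → ∧-comm (x t) (y t))

·-congˡ : ∀ {n} {x x′ : Vect n} (y : Vect n) → x ≗ x′ → x · y ≡ x′ · y
·-congˡ y x≗x′ = ⊕-cong (λ t → cong (_∧ y t) (x≗x′ t))

·-congʳ : ∀ {n} (x : Vect n) {y y′ : Vect n} → y ≗ y′ → x · y ≡ x · y′
·-congʳ x y≗y′ = ⊕-cong (λ t → cong (x t ∧_) (y≗y′ t))

·-zeroʳ : ∀ {n} (x : Vect n) → x · 0ᵥ ≡ false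
·-zeroʳ {n} x = trans (⊕-cong (λ t → ∧-zeroʳ (x t))) (⊕-0ᵥ n)

·-distribˡ-+ᵥ : ∀ {n} (x y z : Vect n) → x · (y +ᵥ z) ≡ x · y xor x · z
·-distribˡ-+ᵥ x y z = trans (⊕-cong (λ t → ∧-distribˡ-xor (x t) (y t) (z t)))
                            (⊕-+ᵥ (λ t → x t ∧ y t) (λ t → x t ∧ z t))

·-distribʳ-+ᵥ : ∀ {n} (x y z : Vect n) → (y +ᵥ z) · x ≡ y · x xor z · x
·-distribʳ-+ᵥ x y z = trans (⊕-cong (λ t → ∧-distribʳ-xor (x t) (y t) (z t)))
                            (⊕-+ᵥ (λ t → y t ∧ x t) (λ t → z t ∧ x t))

*ₛ-· : ∀ {n} a (x y : Vect n) → (a *ₛ x) · y ≡ a ∧ x · y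
*ₛ-· a x y = trans (⊕-cong (λ t → ∧-assoc a (x t) (y t))) (⊕-*ₛ a (λ t → x t ∧ y t))

·-punchIn : ∀ {n} (i : Fin (suc n)) (x y : Vect (suc n)) →
            x · y ≡ x i ∧ y i xor removeAt x i · removeAt y i
·-punchIn i x y = ⊕-punchIn i (λ t → x t ∧ y t)

-- Parity

parity : ℕ → Bool
parity zero    = false
parity (suc m) = not (parity m)

parity-count : ∀ {n} (f : Vect n) → parity (count f) ≡ ⊕ f
parity-count {zero}  f = refl
parity-count {suc n} f with f zero
... | true  = cong not (parity-count (tail f))
... | false = parity-count (tail f)

⊕-1ᵥ : ∀ n → ⊕ {n} (λ _ → true) ≡ parity n
⊕-1ᵥ zero    = refl
⊕-1ᵥ (suc n) = cong not (⊕-1ᵥ n)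

%2≡parity : ∀ m → m % 2 ≡ (if parity m then 1 else 0)
%2≡parity zero          = refl
%2≡parity (suc zero)    = refl
%2≡parity (suc (suc m)) =
  trans (%2≡parity m) (cong (if_then 1 else 0) (sym (not-involutive (parity m))))

Odd⇔parity : ∀ m → Odd m ⇔ parity m ≡ true
Odd⇔parity m with parity m | %2≡parity m
... | true  | m%2≡1 = mk⇔ (λ _ → refl) (λ _ → m%2≡1)
... | false | m%2≡0 = mk⇔ (λ m%2≡1 → contradiction (trans (sym m%2≡0) m%2≡1) λ ()) λ ()

Even⇔parity : ∀ m → Even m ⇔ parity m ≡ false
Even⇔parity m with parity m | %2≡parity m
... | true  | m%2≡1 = mk⇔ (λ m%2≡0 → contradiction (trans (sym m%2≡1) m%2≡0) λ ()) λ ()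
... | false | m%2≡0 = mk⇔ (λ _ → refl) (λ _ → m%2≡0)

parity-≡⇒Odd⇔ : ∀ m n → parity m ≡ parity n → Odd m ⇔ Odd n
parity-≡⇒Odd⇔ m n eq =
  ⇔.trans (Odd⇔parity m) (⇔.trans (mk⇔ (trans (sym eq)) (trans eq)) (⇔.sym (Odd⇔parity n)))

parity-≡⇒Even⇔ : ∀ m n → parity m ≡ parity n → Even m ⇔ Even n
parity-≡⇒Even⇔ m n eq =
  ⇔.trans (Even⇔parity m) (⇔.trans (mk⇔ (trans (sym eq)) (trans eq)) (⇔.sym (Even⇔parity n)))

isOddB≡parity : ∀ m → isOddB m ≡ parity m
isOddB≡parity m rewrite %2≡parity m with parity m
... | true  = refl
... | false = refl

-- Subspaces and bases

record IsSubspace {n} (P : Vect n → Set) : Set where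
  field
    0ᵥ∈       : P 0ᵥ
    +ᵥ-closed : ∀ {x y} → P x → P y → P (x +ᵥ y)

  *ₛ-closed : ∀ a {x} → P x → P (a *ₛ x)
  *ₛ-closed true  x∈P = x∈P
  *ₛ-closed false _   = 0ᵥ∈

lincomb-closed : ∀ {n k} {P : Vect n → Set} {b : Fin k → Vect n} →
                 IsSubspace P → (∀ j → P (b j)) → ∀ c → P (lincomb b c)
lincomb-closed {k = zero}  P-sub b∈P c = IsSubspace.0ᵥ∈ P-sub
lincomb-closed {k = suc k} P-sub b∈P c =
  +ᵥ-closed (*ₛ-closed (c zero) (b∈P zero)) (lincomb-closed P-sub (b∈P ∘ suc) (tail c))
  where open IsSubspace P-sub

IsBasis : ∀ {n} → (Vect n → Set) → ∀ {k} → (Fin k → Vect n) → Set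
IsBasis P b =
  (∀ j → P (b j)) ×
  (∀ c → lincomb b c ≗ 0ᵥ → c ≗ 0ᵥ) ×
  (∀ x → P x → ∃ λ c → lincomb b c ≗ x)

restrict-basis : ∀ {n n′ k} {P : Vect n → Set} {P′ : Vect n′ → Set} {b : Fin k → Vect n} →
  IsSubspace P → (p : Fin n′ → Fin n) →
  (∀ {x} → P x → P′ (x ∘ p)) →
  (∀ {x} → P x → x ∘ p ≗ 0ᵥ → x ≗ 0ᵥ) →
  (∀ {y} → P′ y → ∃ λ x → P x × x ∘ p ≗ y) →
  IsBasis P b → IsBasis P′ (λ j → b j ∘ p)
restrict-basis P-sub p restrict injective surjective (b∈P , independent , spanning) =
  (λ j → restrict (b∈P j)) ,
  (λ c c·b∘p≗0 → independent c (injective (lincomb-closed P-sub b∈P c) c·b∘p≗0)) ,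
  λ y y∈P′ →
    let x , x∈P , x∘p≗y = surjective y∈P′
        c , c·b≗x       = spanning x x∈P
    in  c , λ r → trans (c·b≗x (p r)) (x∘p≗y r)

distrib-elimination : ∀ c u v e → c ∧ (u xor v ∧ e) ≡ c ∧ u xor e ∧ (c ∧ v)
distrib-elimination = solve-∀ ℤ₂

module TailBasis {n} {P : Vect (suc n) → Set} {P′ : Vect n → Set} (P-sub : IsSubspace P)
  (P⇒P′ : ∀ x → P x → P′ (tail x)) (P′⇒P : ∀ x → P′ (tail x) → P x) where

  -- A basis vector with b j 0 = 1 clears coordinate 0 of the others; their tails form a basis of P′.
  module Elimination {k} {b : Fin (suc k) → Vect (suc n)} (basis : IsBasis P b)
                     (j : Fin (suc k)) (bⱼ₀≡true : b j zero ≡ true) where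

    open IsSubspace P-sub
    open ≡-Reasoning

    π : Fin k → Fin (suc k)
    π = punchIn j

    eliminate : Vect (suc n) → Vect (suc n)
    eliminate v = v +ᵥ v zero *ₛ b j

    eliminate-zero : ∀ v → eliminate v zero ≡ false
    eliminate-zero v = begin
      v zero xor v zero ∧ b j zero ≡⟨ cong (λ z → v zero xor v zero ∧ z) bⱼ₀≡true ⟩
      v zero xor v zero ∧ true     ≡⟨ cong (v zero xor_) (∧-identityʳ (v zero)) ⟩
      v zero xor v zero            ≡⟨ xor-same (v zero) ⟩
      false                        ∎

    lincomb-eliminate : ∀ (u : Fin k → Vect (suc n)) c → lincomb (eliminate ∘ u) c ≗ eliminate (lincomb u c)
    lincomb-eliminate u c t = begin
      ⊕ (λ l → c l ∧ (u l t xor u l zero ∧ b j t))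
        ≡⟨ ⊕-cong (λ l → distrib-elimination (c l) (u l t) (u l zero) (b j t)) ⟩
      ⊕ ((λ l → c l ∧ u l t) +ᵥ b j t *ₛ (λ l → c l ∧ u l zero))
        ≡⟨ ⊕-+ᵥ (λ l → c l ∧ u l t) (b j t *ₛ (λ l → c l ∧ u l zero)) ⟩
      lincomb u c t xor ⊕ (b j t *ₛ (λ l → c l ∧ u l zero))
        ≡⟨ cong (lincomb u c t xor_) (trans (⊕-*ₛ (b j t) (λ l → c l ∧ u l zero)) (∧-comm (b j t) _)) ⟩
      lincomb u c t xor lincomb u c zero ∧ b j t
        ∎

    lincomb-punchIn : ∀ c t → lincomb b c t ≡ c j ∧ b j t xor lincomb (b ∘ π) (c ∘ π) t
    lincomb-punchIn c t = ⊕-punchIn j (λ l → c l ∧ b l t)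

    b′ : Fin k → Vect n
    b′ l = tail (eliminate (b (π l)))

    b′-basis : IsBasis P′ b′
    b′-basis = b′∈P′ , b′-independent , b′-spanning
      where
      b∈P           = proj₁ basis
      b-independent = proj₁ (proj₂ basis)
      b-spanning    = proj₂ (proj₂ basis)

      b′∈P′ : ∀ l → P′ (b′ l)
      b′∈P′ l = P⇒P′ _ (+ᵥ-closed (b∈P (π l)) (*ₛ-closed (b (π l) zero) (b∈P j)))

      b′-independent : ∀ c′ → lincomb b′ c′ ≗ 0ᵥ → c′ ≗ 0ᵥ
      b′-independent c′ c′·b′≗0 l = trans (sym (insertAt-punchIn c′ j β l)) (b-independent c c·b≗0 (π l))
        where
        L = lincomb (b ∘ π) c′
        β = L zero
        c = insertAt c′ j β
        eliminated≗0 : lincomb (eliminate ∘ b ∘ π) c′ ≗ 0ᵥ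
        eliminated≗0 zero    = trans (lincomb-eliminate (b ∘ π) c′ zero) (eliminate-zero L)
        eliminated≗0 (suc r) = c′·b′≗0 r
        c·b≗0 : lincomb b c ≗ 0ᵥ
        c·b≗0 t = begin
          lincomb b c t                    ≡⟨ lincomb-punchIn c t ⟩
          c j ∧ b j t xor lincomb (b ∘ π) (c ∘ π) t
            ≡⟨ cong₂ (λ z w → z ∧ b j t xor w) (insertAt-lookup c′ j β)
                     (⊕-cong (λ l → cong (_∧ b (π l) t) (insertAt-punchIn c′ j β l))) ⟩
          β ∧ b j t xor L t                ≡⟨ xor-comm (β ∧ b j t) (L t) ⟩
          eliminate L t                    ≡⟨ sym (lincomb-eliminate (b ∘ π) c′ t) ⟩
          lincomb (eliminate ∘ b ∘ π) c′ t ≡⟨ eliminated≗0 t ⟩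
          false                            ∎

      b′-spanning : ∀ y → P′ y → ∃ λ c′ → lincomb b′ c′ ≗ y
      b′-spanning y y∈P′ = c ∘ π , c′·b′≗y
        where
        c     = proj₁ (b-spanning (false ∷ y) (P′⇒P (false ∷ y) y∈P′))
        c·b≗x = proj₂ (b-spanning (false ∷ y) (P′⇒P (false ∷ y) y∈P′))
        L = lincomb (b ∘ π) (c ∘ π)
        L₀≡cⱼ : L zero ≡ c j
        L₀≡cⱼ = begin
          L zero            ≡⟨ sym (xor-moveʳ (trans (sym (lincomb-punchIn c zero)) (c·b≗x zero))) ⟩
          c j ∧ b j zero    ≡⟨ cong (c j ∧_) bⱼ₀≡true ⟩
          c j ∧ true        ≡⟨ ∧-identityʳ (c j) ⟩
          c j               ∎
        c′·b′≗y : lincomb b′ (c ∘ π) ≗ y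
        c′·b′≗y r = begin
          lincomb (eliminate ∘ b ∘ π) (c ∘ π) (suc r)   ≡⟨ lincomb-eliminate (b ∘ π) (c ∘ π) (suc r) ⟩
          L (suc r) xor L zero ∧ b j (suc r)           ≡⟨ cong (λ z → L (suc r) xor z ∧ b j (suc r)) L₀≡cⱼ ⟩
          L (suc r) xor c j ∧ b j (suc r)              ≡⟨ xor-comm (L (suc r)) _ ⟩
          c j ∧ b j (suc r) xor L (suc r)              ≡⟨ sym (lincomb-punchIn c (suc r)) ⟩
          lincomb b c (suc r)                         ≡⟨ c·b≗x (suc r) ⟩
          y r                                         ∎

  tail-basis : ∀ {k} {b : Fin k → Vect (suc n)} → IsBasis P b →
               ∃ λ k′ → k ≡ suc k′ × ∃ λ (b′ : Fin k′ → Vect n) → IsBasis P′ b′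
  tail-basis {b = b} basis@(_ , _ , b-spanning) = from-pivot basis j (∧-conicalʳ (c j) (b j zero) cⱼ∧bⱼ₀≡true)
    where
    e₀∈P : P (true ∷ 0ᵥ)
    e₀∈P = P′⇒P (true ∷ 0ᵥ) (P⇒P′ 0ᵥ (IsSubspace.0ᵥ∈ P-sub))
    c = proj₁ (b-spanning (true ∷ 0ᵥ) e₀∈P)
    pivot = ⊕≡true⇒∃ (λ l → c l ∧ b l zero) (proj₂ (b-spanning (true ∷ 0ᵥ) e₀∈P) zero)
    j = proj₁ pivot
    cⱼ∧bⱼ₀≡true = proj₂ pivot
    from-pivot : ∀ {k} {b : Fin k → Vect (suc n)} → IsBasis P b → (j : Fin k) → b j zero ≡ true →
                 ∃ λ k′ → k ≡ suc k′ × ∃ λ (b′ : Fin k′ → Vect n) → IsBasis P′ b′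
    from-pivot {suc k} basis j bⱼ₀≡true = k , refl , _ , Elimination.b′-basis basis j bⱼ₀≡true

-- The diagonal of a symmetric matrix

Matrix : ℕ → Set
Matrix n = Fin n → Fin n → Bool

infixr 7 _*ᵥ_

_*ᵥ_ : ∀ {n} → Matrix n → Vect n → Vect n
(M *ᵥ x) r = M r · x

Symmetric : ∀ {n} → Matrix n → Set
Symmetric M = ∀ r s → M r s ≡ M s r

diagonal : ∀ {n} → Matrix n → Vect n
diagonal M i = M i i

Ker : ∀ {n} → Matrix n → Vect n → Set
Ker M x = M *ᵥ x ≗ 0ᵥ

SolvesDiagonal : ∀ {n} → Matrix n → Vect n → Set
SolvesDiagonal M s = M *ᵥ s ≗ diagonal M

*ᵥ-cong : ∀ {n} (M : Matrix n) {x y : Vect n} → x ≗ y → M *ᵥ x ≗ M *ᵥ y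
*ᵥ-cong M x≗y r = ·-congʳ (M r) x≗y

Ker-isSubspace : ∀ {n} (M : Matrix n) → IsSubspace (Ker M)
Ker-isSubspace M = record
  { 0ᵥ∈       = λ r → ·-zeroʳ (M r)
  ; +ᵥ-closed = λ {x} {y} Mx≗0 My≗0 r →
      trans (·-distribˡ-+ᵥ (M r) x y) (cong₂ _xor_ (Mx≗0 r) (My≗0 r))
  }

record DiagonalSystem {n} (M : Matrix n) (k : ℕ) : Set where
  field
    solution : Vect n
    solves   : SolvesDiagonal M solution
    weight   : ∀ {s} → SolvesDiagonal M s → s · diagonal M ≡ parity n xor parity k

DiagonalParity : ℕ → Set
DiagonalParity n = ∀ (M : Matrix n) → Symmetric M →
                   ∀ {k b} → IsBasis (Ker M) {k} b → DiagonalSystem M k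

diagonalParity-zero : DiagonalParity 0
diagonalParity-zero M _ {zero} _ = record { solution = λ () ; solves = λ () ; weight = λ _ → refl }
diagonalParity-zero M _ {suc k} (_ , independent , _) with independent (λ _ → true) (λ ()) zero
... | ()

module ZeroRow {n} (M : Matrix (suc n)) (M-sym : Symmetric M) (row₀ : ∀ j → M zero j ≡ false) where

  M′ : Matrix n
  M′ r s = M (suc r) (suc s)

  M′-sym : Symmetric M′
  M′-sym r s = M-sym (suc r) (suc s)

  *ᵥ-zero : ∀ x → (M *ᵥ x) zero ≡ false
  *ᵥ-zero x = trans (·-congˡ x row₀) (⊕-0ᵥ (suc n))

  *ᵥ-suc : ∀ x r → (M *ᵥ x) (suc r) ≡ (M′ *ᵥ tail x) r
  *ᵥ-suc x r = cong (λ z → z ∧ x zero xor M′ r · tail x) (trans (M-sym (suc r) zero) (row₀ (suc r)))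

  Ker⇒Ker′ : ∀ x → Ker M x → Ker M′ (tail x)
  Ker⇒Ker′ x Mx≗0 r = trans (sym (*ᵥ-suc x r)) (Mx≗0 (suc r))

  Ker′⇒Ker : ∀ x → Ker M′ (tail x) → Ker M x
  Ker′⇒Ker x M′x≗0 zero    = *ᵥ-zero x
  Ker′⇒Ker x M′x≗0 (suc r) = trans (*ᵥ-suc x r) (M′x≗0 r)

  diagonalSystem : DiagonalParity n → ∀ {k b} → IsBasis (Ker M) {k} b → DiagonalSystem M k
  diagonalSystem IH basis with TailBasis.tail-basis {P′ = Ker M′} (Ker-isSubspace M) Ker⇒Ker′ Ker′⇒Ker basis
  ... | k′ , refl , _ , basis′ = record
    { solution = false ∷ solution
    ; solves   = λ { zero → trans (*ᵥ-zero (false ∷ solution)) (sym (row₀ zero))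
                 ; (suc r) → trans (*ᵥ-suc (false ∷ solution) r) (solves r) }
    ; weight   = λ {s} Ms≗d → begin
        s zero ∧ M zero zero xor tail s · diagonal M′
          ≡⟨ cong (λ z → s zero ∧ z xor tail s · diagonal M′) (row₀ zero) ⟩
        s zero ∧ false xor tail s · diagonal M′       ≡⟨ cong (_xor tail s · diagonal M′) (∧-zeroʳ (s zero)) ⟩
        tail s · diagonal M′
          ≡⟨ weight (λ r → trans (sym (*ᵥ-suc s r)) (Ms≗d (suc r))) ⟩
        parity n xor parity k′                        ≡⟨ sym (xor-annihilates-not (parity n) (parity k′)) ⟩
        parity (suc n) xor parity (suc k′)            ∎
    }
    where
    open DiagonalSystem (IH M′ M′-sym basis′)
    open ≡-Reasoning

pivot-identity : ∀ β v c N → β ∧ (v xor c) xor N ≡ (N xor β ∧ c) xor v ∧ β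
pivot-identity = solve-∀ ℤ₂

pivot-weight-identity : ∀ t D → (true xor t) ∧ true xor D ≡ true xor (D xor t)
pivot-weight-identity = solve-∀ ℤ₂

module Pivot {n} (M : Matrix (suc n)) (M-sym : Symmetric M) (i : Fin (suc n)) (Mᵢᵢ≡true : M i i ≡ true) where
  open ≡-Reasoning

  π : Fin n → Fin (suc n)
  π = punchIn i

  a : Vect n
  a r = M (π r) i

  N : Matrix n
  N r s = M (π r) (π s)

  M′ : Matrix n
  M′ r = N r +ᵥ a r *ₛ a

  M′-sym : Symmetric M′
  M′-sym r s = cong₂ _xor_ (M-sym (π r) (π s)) (∧-comm (a r) (a s))

  *ᵥ-pivot : ∀ x → (M *ᵥ x) i ≡ x i xor a · removeAt x i
  *ᵥ-pivot x = trans (·-punchIn i (M i) x)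
                     (cong₂ _xor_ (cong (_∧ x i) Mᵢᵢ≡true) (·-congˡ (removeAt x i) (λ r → M-sym i (π r))))

  *ᵥ-punchIn : ∀ x r → (M *ᵥ x) (π r) ≡ a r ∧ x i xor N r · removeAt x i
  *ᵥ-punchIn x r = ·-punchIn i (M (π r)) x

  M′-*ᵥ : ∀ y r → (M′ *ᵥ y) r ≡ N r · y xor a r ∧ a · y
  M′-*ᵥ y r = trans (·-distribʳ-+ᵥ y (N r) (a r *ₛ a)) (cong (N r · y xor_) (*ₛ-· (a r) a y))

  reduced : Vect (suc n) → Vect n
  reduced v = removeAt v i +ᵥ v i *ₛ a

  solves⇒ : ∀ x {v} → M *ᵥ x ≗ v → x i ≡ v i xor a · removeAt x i × M′ *ᵥ removeAt x i ≗ reduced v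
  solves⇒ x {v} Mx≗v = xᵢ≡ , λ r → trans (M′-*ᵥ y r) (xor-moveʳ (reduced-row r))
    where
    y = removeAt x i
    xᵢ≡ : x i ≡ v i xor a · y
    xᵢ≡ = xor-moveʳ (trans (sym (*ᵥ-pivot x)) (Mx≗v i))
    reduced-row : ∀ r → (N r · y xor a r ∧ a · y) xor v i ∧ a r ≡ v (π r)
    reduced-row r = begin
      (N r · y xor a r ∧ a · y) xor v i ∧ a r ≡⟨ sym (pivot-identity (a r) (v i) (a · y) (N r · y)) ⟩
      a r ∧ (v i xor a · y) xor N r · y       ≡⟨ cong (λ z → a r ∧ z xor N r · y) (sym xᵢ≡) ⟩
      a r ∧ x i xor N r · y                   ≡⟨ sym (*ᵥ-punchIn x r) ⟩
      (M *ᵥ x) (π r)                          ≡⟨ Mx≗v (π r) ⟩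
      v (π r)                                 ∎

  solves⇐ : ∀ x {v} → x i ≡ v i xor a · removeAt x i → M′ *ᵥ removeAt x i ≗ reduced v → M *ᵥ x ≗ v
  solves⇐ x {v} xᵢ≡ M′y≗ = ≗-punchIn i at-pivot off-pivot
    where
    y = removeAt x i
    at-pivot : (M *ᵥ x) i ≡ v i
    at-pivot = trans (*ᵥ-pivot x) (trans (cong (_xor a · y) xᵢ≡) (xor-cancelʳ (v i) (a · y)))
    off-pivot : removeAt (M *ᵥ x) i ≗ removeAt v i
    off-pivot r = begin
      (M *ᵥ x) (π r)                          ≡⟨ *ᵥ-punchIn x r ⟩
      a r ∧ x i xor N r · y                   ≡⟨ cong (λ z → a r ∧ z xor N r · y) xᵢ≡ ⟩
      a r ∧ (v i xor a · y) xor N r · y       ≡⟨ pivot-identity (a r) (v i) (a · y) (N r · y) ⟩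
      (N r · y xor a r ∧ a · y) xor v i ∧ a r ≡⟨ cong (_xor v i ∧ a r) (trans (sym (M′-*ᵥ y r)) (M′y≗ r)) ⟩
      (v (π r) xor v i ∧ a r) xor v i ∧ a r   ≡⟨ xor-cancelʳ (v (π r)) (v i ∧ a r) ⟩
      v (π r)                                 ∎

  kernel-basis : ∀ {k b} → IsBasis (Ker M) {k} b → IsBasis (Ker M′) (λ j → removeAt (b j) i)
  kernel-basis = restrict-basis (Ker-isSubspace M) π (λ {x} Mx≗0 → proj₂ (solves⇒ x Mx≗0)) injective surjective
    where
    injective : ∀ {x} → Ker M x → removeAt x i ≗ 0ᵥ → x ≗ 0ᵥ
    injective {x} Mx≗0 y≗0 =
      ≗-punchIn i (trans (proj₁ (solves⇒ x Mx≗0)) (trans (·-congʳ a y≗0) (·-zeroʳ a))) y≗0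
    surjective : ∀ {y} → Ker M′ y → ∃ λ x → Ker M x × removeAt x i ≗ y
    surjective {y} M′y≗0 = x , solves⇐ x xᵢ≡ (λ r → trans (*ᵥ-cong M′ y′≗y r) (M′y≗0 r)) , y′≗y
      where
      x = insertAt y i (a · y)
      y′≗y = removeAt-insertAt y i (a · y)
      xᵢ≡ : x i ≡ a · removeAt x i
      xᵢ≡ = trans (insertAt-lookup y i (a · y)) (·-congʳ a (λ r → sym (y′≗y r)))

  diagonal-M′ : diagonal M′ ≗ removeAt (diagonal M) i +ᵥ a
  diagonal-M′ r = cong (M (π r) (π r) xor_) (∧-idem (a r))

  reduced-diagonal : reduced (diagonal M) ≗ diagonal M′
  reduced-diagonal r = trans (cong (λ z → M (π r) (π r) xor z ∧ a r) Mᵢᵢ≡true) (sym (diagonal-M′ r))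

  diagonalSystem : DiagonalParity n → ∀ {k b} → IsBasis (Ker M) {k} b → DiagonalSystem M k
  diagonalSystem IH {k} basis = record { solution = s ; solves = s-solves ; weight = λ {t} → s-weight {t} }
    where
    open DiagonalSystem (IH M′ M′-sym (kernel-basis basis))
      renaming (solution to s′; solves to s′-solves; weight to s′-weight)
    s = insertAt s′ i (true xor a · s′)
    s-solves : SolvesDiagonal M s
    s-solves = solves⇐ s sᵢ≡ (λ r → trans (*ᵥ-cong M′ (removeAt-insertAt s′ i _) r)
                                      (trans (s′-solves r) (sym (reduced-diagonal r))))
      where
      sᵢ≡ : s i ≡ M i i xor a · removeAt s i
      sᵢ≡ = trans (insertAt-lookup s′ i _)
                  (cong₂ _xor_ (sym Mᵢᵢ≡true) (·-congʳ a (λ r → sym (removeAt-insertAt s′ i _ r))))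
    s-weight : ∀ {t} → SolvesDiagonal M t → t · diagonal M ≡ parity (suc n) xor parity k
    s-weight {t} Mt≗d = begin
      t · diagonal M                             ≡⟨ ·-punchIn i t (diagonal M) ⟩
      t i ∧ M i i xor y · d′                     ≡⟨ cong₂ (λ z w → z ∧ w xor y · d′) tᵢ≡ Mᵢᵢ≡true ⟩
      (true xor a · y) ∧ true xor y · d′         ≡⟨ cong (λ z → (true xor z) ∧ true xor y · d′) (·-comm a y) ⟩
      (true xor y · a) ∧ true xor y · d′         ≡⟨ pivot-weight-identity (y · a) (y · d′) ⟩
      true xor (y · d′ xor y · a)                ≡⟨ cong (true xor_) (sym (·-distribˡ-+ᵥ y d′ a)) ⟩
      true xor y · (d′ +ᵥ a)                     ≡⟨ cong (true xor_) (·-congʳ y (λ r → sym (diagonal-M′ r))) ⟩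
      true xor y · diagonal M′                   ≡⟨ cong (true xor_) (s′-weight y-solves) ⟩
      not (parity n xor parity k)                ≡⟨ not-distribˡ-xor (parity n) (parity k) ⟩
      parity (suc n) xor parity k                ∎
      where
      y  = removeAt t i
      d′ = removeAt (diagonal M) i
      tᵢ≡ : t i ≡ true xor a · y
      tᵢ≡ = trans (proj₁ (solves⇒ t Mt≗d)) (cong (_xor a · y) Mᵢᵢ≡true)
      y-solves : SolvesDiagonal M′ y
      y-solves r = trans (proj₂ (solves⇒ t Mt≗d) r) (reduced-diagonal r)

hyperbolic-identity : ∀ Ny α X γ Y → (Ny xor α ∧ X) xor γ ∧ Y ≡ α ∧ X xor (γ ∧ Y xor Ny)
hyperbolic-identity = solve-∀ ℤ₂

hyperbolic-symmetry : ∀ N α β γ δ → (N xor α ∧ β) xor γ ∧ δ ≡ (N xor δ ∧ γ) xor β ∧ α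
hyperbolic-symmetry = solve-∀ ℤ₂

module Hyperbolic {m} (M : Matrix (suc (suc m))) (M-sym : Symmetric M) (M-diag : ∀ i → M i i ≡ false)
                  (j₀ : Fin (suc m)) (M₀ⱼ≡true : M zero (suc j₀) ≡ true) where
  open ≡-Reasoning

  j : Fin (suc (suc m))
  j = suc j₀

  π : Fin m → Fin (suc (suc m))
  π r = suc (punchIn j₀ r)

  rest : Vect (suc (suc m)) → Vect m
  rest x = x ∘ π

  a c : Vect m
  a r = M (π r) zero
  c r = M (π r) j

  N : Matrix m
  N r s = M (π r) (π s)

  M′ : Matrix m
  M′ r = N r +ᵥ a r *ₛ c +ᵥ c r *ₛ a

  M′-sym : Symmetric M′
  M′-sym r s = trans (cong (λ z → (z xor a r ∧ c s) xor c r ∧ a s) (M-sym (π r) (π s)))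
                     (hyperbolic-symmetry (N s r) (a r) (c s) (c r) (a s))

  ·-split : ∀ u x → u · x ≡ u zero ∧ x zero xor (u j ∧ x j xor rest u · rest x)
  ·-split u x = cong (u zero ∧ x zero xor_) (·-punchIn j₀ (tail u) (tail x))

  *ᵥ-zero : ∀ x → (M *ᵥ x) zero ≡ x j xor a · rest x
  *ᵥ-zero x = begin
    M zero · x                                                           ≡⟨ ·-split (M zero) x ⟩
    M zero zero ∧ x zero xor (M zero j ∧ x j xor rest (M zero) · rest x)
      ≡⟨ cong₂ (λ z w → z ∧ x zero xor (w ∧ x j xor rest (M zero) · rest x)) (M-diag zero) M₀ⱼ≡true ⟩
    x j xor rest (M zero) · rest x   ≡⟨ cong (x j xor_) (·-congˡ (rest x) (λ r → M-sym zero (π r))) ⟩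
    x j xor a · rest x               ∎

  *ᵥ-j : ∀ x → (M *ᵥ x) j ≡ x zero xor c · rest x
  *ᵥ-j x = begin
    M j · x                                                     ≡⟨ ·-split (M j) x ⟩
    M j zero ∧ x zero xor (M j j ∧ x j xor rest (M j) · rest x)
      ≡⟨ cong₂ (λ z w → z ∧ x zero xor (w ∧ x j xor rest (M j) · rest x))
               (trans (M-sym j zero) M₀ⱼ≡true) (M-diag j) ⟩
    x zero xor rest (M j) · rest x   ≡⟨ cong (x zero xor_) (·-congˡ (rest x) (λ r → M-sym j (π r))) ⟩
    x zero xor c · rest x            ∎

  M′-*ᵥ : ∀ y r → (M′ *ᵥ y) r ≡ (N r · y xor a r ∧ c · y) xor c r ∧ a · y
  M′-*ᵥ y r = begin
    (N r +ᵥ a r *ₛ c +ᵥ c r *ₛ a) · y           ≡⟨ ·-distribʳ-+ᵥ y (N r +ᵥ a r *ₛ c) (c r *ₛ a) ⟩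
    (N r +ᵥ a r *ₛ c) · y xor (c r *ₛ a) · y
      ≡⟨ cong₂ _xor_ (·-distribʳ-+ᵥ y (N r) (a r *ₛ c)) (*ₛ-· (c r) a y) ⟩
    (N r · y xor (a r *ₛ c) · y) xor c r ∧ a · y
      ≡⟨ cong (λ z → (N r · y xor z) xor c r ∧ a · y) (*ₛ-· (a r) c y) ⟩
    (N r · y xor a r ∧ c · y) xor c r ∧ a · y    ∎

  M′-*ᵥ-rest : ∀ x → x zero ≡ c · rest x → x j ≡ a · rest x → ∀ r → (M′ *ᵥ rest x) r ≡ (M *ᵥ x) (π r)
  M′-*ᵥ-rest x x₀≡ xⱼ≡ r = begin
    (M′ *ᵥ rest x) r                                       ≡⟨ M′-*ᵥ (rest x) r ⟩
    (N r · rest x xor a r ∧ c · rest x) xor c r ∧ a · rest x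
      ≡⟨ cong₂ (λ z w → (N r · rest x xor a r ∧ z) xor c r ∧ w) (sym x₀≡) (sym xⱼ≡) ⟩
    (N r · rest x xor a r ∧ x zero) xor c r ∧ x j          ≡⟨ hyperbolic-identity _ (a r) (x zero) (c r) (x j) ⟩
    a r ∧ x zero xor (c r ∧ x j xor N r · rest x)          ≡⟨ sym (·-split (M (π r)) x) ⟩
    (M *ᵥ x) (π r)                                         ∎

  Ker⇒ : ∀ x → Ker M x → x zero ≡ c · rest x × x j ≡ a · rest x
  Ker⇒ x Mx≗0 = xor-moveʳ (trans (sym (*ᵥ-j x)) (Mx≗0 j)) , xor-moveʳ (trans (sym (*ᵥ-zero x)) (Mx≗0 zero))

  Ker⇐ : ∀ x → x zero ≡ c · rest x → x j ≡ a · rest x → Ker M′ (rest x) → Ker M x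
  Ker⇐ x x₀≡ xⱼ≡ M′y≗0 zero    = trans (*ᵥ-zero x) (trans (cong (_xor a · rest x) xⱼ≡) (xor-same (a · rest x)))
  Ker⇐ x x₀≡ xⱼ≡ M′y≗0 (suc t) = ≗-punchIn j₀ {x = tail (M *ᵥ x)} {y = 0ᵥ} at-j off-pivots t
    where
    at-j = trans (*ᵥ-j x) (trans (cong (_xor c · rest x) x₀≡) (xor-same (c · rest x)))
    off-pivots : ∀ r → (M *ᵥ x) (π r) ≡ false
    off-pivots r = trans (sym (M′-*ᵥ-rest x x₀≡ xⱼ≡ r)) (M′y≗0 r)

  kernel-basis : ∀ {k b} → IsBasis (Ker M) {k} b → IsBasis (Ker M′) (λ l → rest (b l))
  kernel-basis = restrict-basis (Ker-isSubspace M) π (λ {x} → restrict {x}) injective surjective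
    where
    restrict : ∀ {x} → Ker M x → Ker M′ (rest x)
    restrict {x} Mx≗0 r = let x₀≡ , xⱼ≡ = Ker⇒ x Mx≗0 in trans (M′-*ᵥ-rest x x₀≡ xⱼ≡ r) (Mx≗0 (π r))
    injective : ∀ {x} → Ker M x → rest x ≗ 0ᵥ → x ≗ 0ᵥ
    injective {x} Mx≗0 y≗0 zero    = trans (proj₁ (Ker⇒ x Mx≗0)) (trans (·-congʳ c y≗0) (·-zeroʳ c))
    injective {x} Mx≗0 y≗0 (suc t) =
      ≗-punchIn j₀ {x = tail x} {y = 0ᵥ} (trans (proj₂ (Ker⇒ x Mx≗0)) (trans (·-congʳ a y≗0) (·-zeroʳ a))) y≗0 t
    surjective : ∀ {y} → Ker M′ y → ∃ λ x → Ker M x × rest x ≗ y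
    surjective {y} M′y≗0 = x , Ker⇐ x x₀≡ xⱼ≡ (λ r → trans (*ᵥ-cong M′ rest≗y r) (M′y≗0 r)) , rest≗y
      where
      x = c · y ∷ insertAt y j₀ (a · y)
      rest≗y : rest x ≗ y
      rest≗y = insertAt-punchIn y j₀ (a · y)
      y≗rest : y ≗ rest x
      y≗rest r = sym (rest≗y r)
      x₀≡ : x zero ≡ c · rest x
      x₀≡ = ·-congʳ c y≗rest
      xⱼ≡ : x j ≡ a · rest x
      xⱼ≡ = trans (insertAt-lookup y j₀ (a · y)) (·-congʳ a y≗rest)

  diagonalSystem : DiagonalParity m → ∀ {k b} → IsBasis (Ker M) {k} b → DiagonalSystem M k
  diagonalSystem IH {k} basis = record
    { solution = 0ᵥ
    ; solves   = λ r → trans (·-zeroʳ (M r)) (sym (M-diag r))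
    ; weight   = λ {t} _ → begin
        t · diagonal M                ≡⟨ trans (·-congʳ t M-diag) (·-zeroʳ t) ⟩
        false                         ≡⟨ sym m+k-even ⟩
        parity m xor parity k         ≡⟨ cong (_xor parity k) (sym (not-involutive (parity m))) ⟩
        parity (suc (suc m)) xor parity k ∎
    }
    where
    diagonal-M′ : diagonal M′ ≗ 0ᵥ
    diagonal-M′ r = trans (cong₂ (λ z w → (z xor a r ∧ c r) xor w) (M-diag (π r)) (∧-comm (c r) (a r)))
                          (xor-same (a r ∧ c r))
    m+k-even : parity m xor parity k ≡ false
    m+k-even = trans (sym (DiagonalSystem.weight (IH M′ M′-sym (kernel-basis basis))
                             (λ r → trans (·-zeroʳ (M′ r)) (sym (diagonal-M′ r)))))
                     (⊕-0ᵥ m)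

diagonalParity : ∀ n → DiagonalParity n
diagonalParity = <-rec DiagonalParity step
  where
  hyperbolic : ∀ n → (∀ {m} → m < suc n → DiagonalParity m) → (M : Matrix (suc n)) → Symmetric M →
               (∀ i → M i i ≡ false) → (j : Fin n) → M zero (suc j) ≡ true →
               ∀ {k b} → IsBasis (Ker M) {k} b → DiagonalSystem M k
  hyperbolic (suc m) rec M M-sym M-diag j M₀ⱼ≡true =
    Hyperbolic.diagonalSystem M M-sym M-diag j M₀ⱼ≡true (rec (m<n⇒m<1+n (n<1+n m)))

  step : ∀ n → (∀ {m} → m < n → DiagonalParity m) → DiagonalParity n
  step zero    _   = diagonalParity-zero
  step (suc n) rec M M-sym basis
    with Fin.any? (λ i → M i i Bool.≟ true) | Fin.any? (λ j → M zero (suc j) Bool.≟ true)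
  ... | yes (i , Mᵢᵢ≡true) | _                  = Pivot.diagonalSystem M M-sym i Mᵢᵢ≡true (rec (n<1+n n)) basis
  ... | no ¬diag          | yes (j , M₀ⱼ≡true) = hyperbolic n rec M M-sym M-diag j M₀ⱼ≡true basis
    where
    M-diag : ∀ i → M i i ≡ false
    M-diag i = ¬-not (¬diag ∘ (i ,_))
  ... | no ¬diag          | no ¬row            = ZeroRow.diagonalSystem M M-sym row₀ (rec (n<1+n n)) basis
    where
    row₀ : ∀ j → M zero j ≡ false
    row₀ zero    = ¬-not (¬diag ∘ (zero ,_))
    row₀ (suc j) = ¬-not (¬row ∘ (j ,_))

-- Odd dominating sets

inN-sym : ∀ {n} (G : Graph n) u w → inN G u w ≡ inN G w u
inN-sym G u w with w Fin.≟ u | u Fin.≟ w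
... | yes _    | yes _    = refl
... | yes refl | no u≢u   = contradiction refl u≢u
... | no w≢w   | yes refl = contradiction refl w≢w
... | no _     | no _     = Graph.sym G u w

inN-self : ∀ {n} (G : Graph n) u → inN G u u ≡ true
inN-self G u = cong (if_then true else adj G u u) (dec-true (u Fin.≟ u) refl)

inN-punchIn : ∀ {n} (G : Graph (suc n)) u r → inN G u (punchIn u r) ≡ adj G u (punchIn u r)
inN-punchIn G u r =
  cong (if_then true else adj G u (punchIn u r)) (dec-false (punchIn u r Fin.≟ u) (Fin.punchInᵢ≢i u r))

NMat-sym : ∀ {n} (G : Graph n) → Symmetric (NMat G)
NMat-sym G r s = inN-sym G s r

closedNeighbourhood-· : ∀ {n} (G : Graph n) S u → inN G u · S ≡ S u xor adj G u · S
closedNeighbourhood-· {suc n} G S u = begin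
  inN G u · S                                        ≡⟨ ·-punchIn u (inN G u) S ⟩
  inN G u u ∧ S u xor removeAt (inN G u) u · S′
    ≡⟨ cong₂ (λ z w → z ∧ S u xor w) (inN-self G u) (·-congˡ S′ (inN-punchIn G u)) ⟩
  S u xor removeAt (adj G u) u · S′
    ≡⟨ cong (λ z → S u xor (z ∧ S u xor removeAt (adj G u) u · S′)) (sym (loopless G u)) ⟩
  S u xor (adj G u u ∧ S u xor removeAt (adj G u) u · S′) ≡⟨ cong (S u xor_) (sym (·-punchIn u (adj G u) S)) ⟩
  S u xor adj G u · S                                ∎
  where
  open ≡-Reasoning
  S′ = removeAt S u

closedNeighbourhood-parity : ∀ {n} (G : Graph n) S u → parity (count (λ w → inN G u w ∧ S w)) ≡ (NMat G *ᵥ S) u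
closedNeighbourhood-parity G S u = trans (parity-count (λ w → inN G u w ∧ S w)) (·-congˡ S (inN-sym G u))

oddDominating⇔solvesDiagonal : ∀ {n} (G : Graph n) S → OddDominating G S ⇔ SolvesDiagonal (NMat G) S
oddDominating⇔solvesDiagonal G S = mk⇔
  (λ odd u → trans (sym (closedNeighbourhood-parity G S u))
                   (trans (Equivalence.to (Odd⇔parity (N∩S u)) (odd u)) (sym (inN-self G u))))
  (λ solves u → Equivalence.from (Odd⇔parity (N∩S u))
                  (trans (closedNeighbourhood-parity G S u) (trans (solves u) (inN-self G u))))
  where
  N∩S : _ → ℕ
  N∩S u = count (λ w → inN G u w ∧ S w)

⊕-oddDegrees : ∀ {n} (G : Graph n) S → ⊕ (λ v → S v ∧ isOddB (degree G v)) ≡ ⊕ (λ w → adj G w · S)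
⊕-oddDegrees G S = begin
  ⊕ (λ v → S v ∧ isOddB (degree G v))
    ≡⟨ ⊕-cong (λ v → cong (S v ∧_) (trans (isOddB≡parity (degree G v)) (parity-count (adj G v)))) ⟩
  ⊕ (λ v → S v ∧ ⊕ (adj G v))         ≡⟨ ⊕-cong (λ v → sym (⊕-*ₛ (S v) (adj G v))) ⟩
  ⊕ (λ v → ⊕ (S v *ₛ adj G v))         ≡⟨ ⊕-comm (λ v → S v *ₛ adj G v) ⟩
  ⊕ (λ w → ⊕ (λ v → S v ∧ adj G v w))
    ≡⟨ ⊕-cong (λ w → ⊕-cong (λ v → trans (∧-comm (S v) (adj G v w)) (cong (_∧ S v) (Graph.sym G v w)))) ⟩
  ⊕ (λ w → adj G w · S)               ∎
  where open ≡-Reasoning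

oddDominatingSet : ∀ {n} (G : Graph n) {ν} → Nullity G ν → ∃ (OddDominating G)
oddDominatingSet {n} G (_ , basis) =
  solution , Equivalence.from (oddDominating⇔solvesDiagonal G solution) solves
  where open DiagonalSystem (diagonalParity n (NMat G) (NMat-sym G) basis)

oddDegreeCount-parity : ∀ {n} (G : Graph n) {ν} → Nullity G ν →
                        ∀ {S} → OddDominating G S → parity (oddDegreeCount G S) ≡ parity ν
oddDegreeCount-parity {n} G {ν} (_ , basis) {S} S-odd = begin
  parity (oddDegreeCount G S)           ≡⟨ parity-count (λ v → S v ∧ isOddB (degree G v)) ⟩
  ⊕ (λ v → S v ∧ isOddB (degree G v))   ≡⟨ ⊕-oddDegrees G S ⟩
  ⊕ (λ w → adj G w · S)                 ≡⟨ ⊕-cong openNeighbourhood-· ⟩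
  ⊕ ((λ _ → true) +ᵥ S)                 ≡⟨ ⊕-+ᵥ (λ _ → true) S ⟩
  ⊕ {n} (λ _ → true) xor ⊕ S            ≡⟨ cong₂ _xor_ (⊕-1ᵥ n) ⊕S≡ ⟩
  parity n xor (parity n xor parity ν)  ≡⟨ xor-cancelˡ (parity n) (parity ν) ⟩
  parity ν                              ∎
  where
  open ≡-Reasoning
  solves = Equivalence.to (oddDominating⇔solvesDiagonal G S) S-odd
  openNeighbourhood-· : ∀ w → adj G w · S ≡ true xor S w
  openNeighbourhood-· w = xor-moveʳ (begin
    adj G w · S xor S w   ≡⟨ xor-comm (adj G w · S) (S w) ⟩
    S w xor adj G w · S   ≡⟨ sym (closedNeighbourhood-· G S w) ⟩
    inN G w · S           ≡⟨ ·-congˡ S (λ u → inN-sym G w u) ⟩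
    (NMat G *ᵥ S) w       ≡⟨ trans (solves w) (inN-self G w) ⟩
    true                  ∎)
  ⊕S≡ : ⊕ S ≡ parity n xor parity ν
  ⊕S≡ = begin
    ⊕ S
      ≡⟨ ⊕-cong (λ t → trans (sym (∧-identityʳ (S t))) (cong (S t ∧_) (sym (inN-self G t)))) ⟩
    S · diagonal (NMat G) ≡⟨ DiagonalSystem.weight (diagonalParity n (NMat G) (NMat-sym G) basis) solves ⟩
    parity n xor parity ν ∎

corollary3p4 : ∀ {n} (G : Graph n) (ν : ℕ) → Nullity G ν →
    ((∀ S → OddDominating G S → Odd (oddDegreeCount G S)) ⇔ Odd ν)
    × ((∀ S → OddDominating G S → Even (oddDegreeCount G S)) ⇔ Even ν)
    × (Nullity G 0 → ∀ S → OddDominating G S → Even (oddDegreeCount G S))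
corollary3p4 G ν nullity =
  mk⇔ (λ all-odd → Equivalence.to (Odd⇔ S₀-odd) (all-odd S₀ S₀-odd))
      (λ ν-odd S S-odd → Equivalence.from (Odd⇔ S-odd) ν-odd) ,
  mk⇔ (λ all-even → Equivalence.to (Even⇔ S₀-odd) (all-even S₀ S₀-odd))
      (λ ν-even S S-odd → Equivalence.from (Even⇔ S-odd) ν-even) ,
  λ nullity₀ S S-odd →
    Equivalence.from (parity-≡⇒Even⇔ (oddDegreeCount G S) 0 (oddDegreeCount-parity G nullity₀ S-odd)) refl
  where
  S₀     = proj₁ (oddDominatingSet G nullity)
  S₀-odd = proj₂ (oddDominatingSet G nullity)
  Odd⇔ : ∀ {S} → OddDominating G S → Odd (oddDegreeCount G S) ⇔ Odd ν
  Odd⇔ {S} S-odd = parity-≡⇒Odd⇔ (oddDegreeCount G S) ν (oddDegreeCount-parity G nullity S-odd)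
  Even⇔ : ∀ {S} → OddDominating G S → Even (oddDegreeCount G S) ⇔ Even ν
  Even⇔ {S} S-odd = parity-≡⇒Even⇔ (oddDegreeCount G S) ν (oddDegreeCount-parity G nullity S-odd)
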